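{- Let $G=(V,E)$ be a directed simple $st$-graph and let $b\in V$ be a critical node. Then every $b$-minimal minimal vertex separator of $G$ is $b$-critical.
   Context: A directed simple $st$-graph is a finite directed graph without self-loops or parallel edges, with distinguished source $s$ (no incoming edges) and sink $t\ne s$ (no outgoing edges), every vertex lying on some directed walk from $s$ to $t$. A minimal vertex separator (mvs) is an inclusion-minimal $T\subseteq V$ such that every directed walk from $s$ to $t$ contains a vertex of $T$. An mvs $T$ is $b$-critical if $b\in T$ and there exist $a\in T$ and a directed walk from $a$ to $b$ with at least one edge; $b$ is a critical node if some mvs is $b$-critical. For $u\in V$, $A\subseteq V$: $u\sqsubseteq A$ means every directed walk from $u$ to $t$ contains a vertex of $A$; $A\sqsubseteq A'$ means $u\sqsubseteq A'$ for all $u\in A$; $A\sqsubset A'$ means $A\sqsubseteq A'$ and $A\neq A'$. An mvs $T$ is $b$-minimal if $b\in T$ and $b\notin T'$ for every mvs $T'\sqsubset T$. -}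

module Defs where

open import Data.Nat using (ℕ)
open import Data.Fin using (Fin)
open import Data.Fin.Subset using (Subset; _∈_; _∉_; _⊆_)
open import Data.List using (List; []; _∷_)
open import Data.List.Relation.Unary.Any using (Any)
open import Data.Product using (Σ; ∃; _×_; _,_)
open import Relation.Nullary using (¬_; Dec)
open import Relation.Binary.PropositionalEquality using (_≡_; _≢_)

-- A finite directed graph on vertex set Fin n; the edge relation is a
-- (decidable) relation, so there are no parallel edges by construction.
-- directed walks from u to v along the edge relation E
data Walk {n : ℕ} (E : Fin n → Fin n → Set) : Fin n → Fin n → Set where
  [] : ∀ {u} → Walk E u u
  _∷_ : ∀ {u w v} → E u w → Walk E w v → Walk E u v

verts : ∀ {n} {E : Fin n → Fin n → Set} {u v} → Walk E u v → List (Fin n)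
verts {u = u} [] = u ∷ []
verts {u = u} (_ ∷ w) = u ∷ verts w

Hits : ∀ {n} {E : Fin n → Fin n → Set} {u v} → Walk E u v → Subset n → Set
Hits w A = Any (λ x → x ∈ A) (verts w)

record StGraph : Set₁ where
  field
    n      : ℕ
    E      : Fin n → Fin n → Set
    E?     : ∀ u v → Dec (E u v)
    noLoop : ∀ v → ¬ E v v
    s      : Fin n
    t      : Fin n
    s≢t    : s ≢ t

  field
    s-noIn   : ∀ u → ¬ E u s
    t-noOut  : ∀ v → ¬ E t v
    onWalk   : ∀ v → Walk E s v × Walk E v t

  Separator : Subset n → Set
  Separator T = (w : Walk E s t) → Hits w T

  IsMVS : Subset n → Set
  IsMVS T = Separator T × (∀ T' → T' ⊆ T → Separator T' → T' ≡ T)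

  _⊑ᵥ_ : Fin n → Subset n → Set
  u ⊑ᵥ A = (w : Walk E u t) → Hits w A

  _⊑_ : Subset n → Subset n → Set
  A ⊑ A' = ∀ u → u ∈ A → u ⊑ᵥ A'

  _⊏_ : Subset n → Subset n → Set
  A ⊏ A' = A ⊑ A' × A ≢ A'

  IsCritical : Fin n → Subset n → Set
  IsCritical b T = IsMVS T × b ∈ T ×
    Σ (Fin n) (λ a → a ∈ T × Σ (Fin n) (λ c → E a c × Walk E c b))

  CriticalNode : Fin n → Set
  CriticalNode b = ∃ λ T → IsCritical b T

  IsMinimal : Fin n → Subset n → Set
  IsMinimal b T = IsMVS T × b ∈ T × (∀ T' → IsMVS T' → T' ⊏ T → b ∉ T')

module Submission where

-- Suppose T is b-minimal but not b-critical, and let T₀ be a b-critical mvs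
-- with a₀ ∈ T₀ and a walk a₀ → c₀ ⇝ b; no vertex of T starts a nonempty
-- walk to b.  For a separator X let front X be the vertices of X reachable
-- from s without meeting X earlier, and closest X those vertices of front X
-- from which t is reachable without meeting front X again: closest X is an
-- mvs, and closest X ⊑ A for every separator A ⊆ X.  For X = T ∪ T₀ the
-- mvs Z = closest X satisfies Z ⊑ T; private walks of b (in T₀ and in T)
-- show b ∈ Z, and the private walk of a₀ in T₀ finds a vertex of T outside
-- Z.  So Z ⊏ T with b ∈ Z, contradicting b-minimality; since criticality is
-- decidable (reachability in finite graphs is), this proves the claim.

open import Defs
open import Data.Nat using (ℕ; zero; suc; _≤_; _<_)
open import Data.Nat.Properties using (≤-refl; ≤-pred; <-≤-trans)
open import Data.Fin using (Fin; _≟_)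
open import Data.Fin.Subset using (Subset; _∈_; _∉_; _⊆_; _∪_; _-_; ⁅_⁆)
open import Data.Fin.Subset.Properties
  using (⊆-antisym; p⊆p∪q; q⊆p∪q; x∈p∪q⁻; p─q⊆p; x∈p∧x≢y⇒x∈p-y; x∈p⇒p-x⊂p)
  renaming (_∈?_ to _∈ˢ?_)
open import Data.Fin.Properties using (any?)
open import Data.List using (List; []; _∷_; length; filter; allFin)
open import Data.List.Relation.Unary.Any as Any using (Any; here; there)
open import Data.List.Relation.Unary.Any.Properties using (¬Any[])
open import Data.List.Relation.Unary.All as All using (All; []; _∷_)
open import Data.List.Relation.Unary.All.Properties using (¬Any⇒All¬; All¬⇒¬Any)
import Data.List.Membership.Propositional as List
open import Data.List.Membership.Propositional.Properties using (∈-filter⁺; ∈-filter⁻; ∈-allFin)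
open import Data.List.Properties using (filter-notAll)
open import Data.Product using (Σ; _×_; _,_; proj₁; proj₂)
open import Data.Sum using (_⊎_; inj₁; inj₂)
open import Data.Empty using (⊥; ⊥-elim)
open import Data.Unit using (⊤; tt)
open import Data.Vec using (tabulate)
open import Data.Vec.Properties using (lookup∘tabulate; []=⇒lookup; lookup⇒[]=)
open import Relation.Nullary using (¬_; Dec; yes; no; does)
open import Relation.Nullary.Decidable using (dec-true; _×-dec_; _⊎-dec_; _→-dec_; ¬?)
open import Relation.Binary.PropositionalEquality using (_≡_; _≢_; refl; sym; trans; subst)

⟦_⟧ : ∀ {n} {P : Fin n → Set} → (∀ v → Dec (P v)) → Subset n
⟦ P? ⟧ = tabulate (λ v → does (P? v))

∈⟦⟧⁺ : ∀ {n} {P : Fin n → Set} (P? : ∀ v → Dec (P v)) {v} → P v → v ∈ ⟦ P? ⟧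
∈⟦⟧⁺ P? {v} p = lookup⇒[]= v ⟦ P? ⟧ (trans (lookup∘tabulate _ v) (dec-true (P? v) p))

∈⟦⟧⁻ : ∀ {n} {P : Fin n → Set} (P? : ∀ v → Dec (P v)) {v} → v ∈ ⟦ P? ⟧ → P v
∈⟦⟧⁻ P? {v} v∈ with P? v | trans (sym (lookup∘tabulate (λ v → does (P? v)) v)) ([]=⇒lookup v∈)
... | yes p | _ = p
... | no _  | ()

module Walks {n : ℕ} (E : Fin n → Fin n → Set) (E? : ∀ u v → Dec (E u v)) where

  infixr 5 _++ʷ_
  _++ʷ_ : ∀ {u v w} → Walk E u v → Walk E v w → Walk E u w
  [] ++ʷ q = q
  (e ∷ p) ++ʷ q = e ∷ (p ++ʷ q)

  All-++ʷ : ∀ {P : Fin n → Set} {u v w} (p : Walk E u v) (q : Walk E v w) →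
    All P (verts p) → All P (verts q) → All P (verts (p ++ʷ q))
  All-++ʷ [] q _ Pq = Pq
  All-++ʷ (e ∷ p) q (Pu ∷ Pp) Pq = Pu ∷ All-++ʷ p q Pp Pq

  All-head : ∀ {P : Fin n → Set} {u v} (p : Walk E u v) → All P (verts p) → P u
  All-head [] (Pu ∷ _) = Pu
  All-head (_ ∷ _) (Pu ∷ _) = Pu

  All-last : ∀ {P : Fin n → Set} {u v} (p : Walk E u v) → All P (verts p) → P v
  All-last [] (Pv ∷ _) = Pv
  All-last (e ∷ p) (_ ∷ Pp) = All-last p Pp

  ReachIn : (Fin n → Set) → Fin n → Fin n → Set
  ReachIn Q u v = Σ (Walk E u v) λ w → All Q (verts w)

  reachIn-edge : ∀ {Q : Fin n → Set} {x y z w} → ReachIn Q x y → E y z → ReachIn Q z w → ReachIn Q x w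
  reachIn-edge (p , Qp) e (q , Qq) = p ++ʷ (e ∷ q) , All-++ʷ p (e ∷ q) Qp (All-last p Qp ∷ Qq)

  split : ∀ {Q : Fin n → Set} {u v} (w : Walk E u v) → Any Q (verts w) →
    Σ (Fin n) λ x → Q x × Σ (Walk E u x) λ w₁ → Σ (Walk E x v) λ w₂ →
      (∀ {P : Fin n → Set} → All P (verts w) → All P (verts w₁) × All P (verts w₂))
  split [] (here q) = _ , q , [] , [] , λ Pw → Pw , Pw
  split (e ∷ w) (here q) = _ , q , [] , e ∷ w , λ { (Pu ∷ Pw) → Pu ∷ [] , Pu ∷ Pw }
  split (e ∷ w) (there hit) with split w hit
  ... | x , q , w₁ , w₂ , restrict =
    x , q , e ∷ w₁ , w₂ , λ { (Pu ∷ Pw) → Pu ∷ proj₁ (restrict Pw) , proj₂ (restrict Pw) }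

  prefix : ∀ {u v y} (w : Walk E u v) → y List.∈ verts w → Walk E u y
  prefix w y∈w with split w y∈w
  ... | _ , refl , w₁ , _ , _ = w₁

  suffix : ∀ {u v y} (w : Walk E u v) → y List.∈ verts w → Walk E y v
  suffix w y∈w with split w y∈w
  ... | _ , refl , _ , w₂ , _ = w₂

  suffixReach : ∀ {Q : Fin n → Set} {u v y} (w : Walk E u v) → All Q (verts w) → y List.∈ verts w → ReachIn Q y v
  suffixReach w Qw y∈w with split w y∈w
  ... | _ , refl , _ , w₂ , restrict = w₂ , proj₂ (restrict Qw)

  AllBeforeEnd : ∀ {u v} → (Fin n → Set) → Walk E u v → Set
  AllBeforeEnd P [] = ⊤
  AllBeforeEnd {u} P (e ∷ w) = P u × AllBeforeEnd P w

  AllBeforeEnd-zipWith : ∀ {P Q R : Fin n → Set} → (∀ {a} → P a → Q a → R a) →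
    ∀ {u v} (w : Walk E u v) → AllBeforeEnd P w → All Q (verts w) → AllBeforeEnd R w
  AllBeforeEnd-zipWith f [] _ _ = tt
  AllBeforeEnd-zipWith f (e ∷ w) (p , ps) (q ∷ qs) = f p q , AllBeforeEnd-zipWith f w ps qs

  ReachBefore : (Fin n → Set) → Fin n → Fin n → Set
  ReachBefore Q x v = (x ≡ v) ⊎ Σ (Fin n) λ u → ReachIn Q x u × E u v

  ReachAfter : (Fin n → Set) → Fin n → Fin n → Set
  ReachAfter Q v y = (v ≡ y) ⊎ Σ (Fin n) λ u → E v u × ReachIn Q u y

  reachBefore-walk : ∀ {Q : Fin n → Set} {x v} (w : Walk E x v) → AllBeforeEnd Q w → ReachBefore Q x v
  reachBefore-walk [] _ = inj₁ refl
  reachBefore-walk (e ∷ w) (q , qs) with reachBefore-walk w qs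
  ... | inj₁ refl = inj₂ (_ , ([] , q ∷ []) , e)
  ... | inj₂ (u , (p , Qp) , e') = inj₂ (u , (e ∷ p , q ∷ Qp) , e')

  reachBefore-step : ∀ {Q : Fin n → Set} {x u u'} → ReachBefore Q x u → Q u → E u u' → ReachBefore Q x u'
  reachBefore-step (inj₁ refl) Qu e = inj₂ (_ , ([] , Qu ∷ []) , e)
  reachBefore-step (inj₂ (_ , r , e')) Qu e = inj₂ (_ , reachIn-edge r e' ([] , Qu ∷ []) , e)

  reachBefore-join : ∀ {Q R : Fin n → Set} {x v y} → ReachBefore Q x v → (∀ {a} → Q a → R a) →
    ReachIn R v y → ReachIn R x y
  reachBefore-join (inj₁ refl) _ r = r
  reachBefore-join (inj₂ (_ , (p , Qp) , e)) Q⇒R r = reachIn-edge (p , All.map Q⇒R Qp) e r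

  reachAfter-walk : ∀ {Q R : Fin n → Set} {v y} → ReachAfter Q v y → (∀ {a} → Q a → R a) → R v → ReachIn R v y
  reachAfter-walk (inj₁ refl) _ Rv = [] , Rv ∷ []
  reachAfter-walk (inj₂ (_ , e , (p , Qp))) Q⇒R Rv = e ∷ p , Rv ∷ All.map Q⇒R Qp

  firstHit : ∀ {P : Fin n → Set} (P? : ∀ v → Dec (P v)) {x u v} (w : Walk E u v) →
    ReachBefore (λ a → ¬ P a) x u → Any P (verts w) →
    Any (λ y → P y × ReachBefore (λ a → ¬ P a) x y) (verts w)
  firstHit P? [] before (here p) = here (p , before)
  firstHit P? {u = u} (e ∷ w) before hit with P? u
  ... | yes p = here (p , before)
  ... | no ¬p = there (firstHit P? w (reachBefore-step before ¬p e) (Any.tail ¬p hit))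

  lastHit : ∀ {P : Fin n → Set} (P? : ∀ v → Dec (P v)) {u v} (w : Walk E u v) → Any P (verts w) →
    Any (λ y → P y × ReachAfter (λ a → ¬ P a) y v) (verts w)
  lastHit P? [] (here p) = here (p , inj₁ refl)
  lastHit P? (e ∷ w) hit with Any.any? P? (verts w)
  ... | yes later = there (lastHit P? w later)
  ... | no none = here (Any.head none hit , inj₂ (_ , e , w , ¬Any⇒All¬ _ none))

  cutAtLastVisit : ∀ {Q : Fin n → Set} (x : Fin n) {y v} (w : Walk E y v) → All Q (verts w) →
    All (_≢ x) (verts w) ⊎ (x ≡ v) ⊎
      Σ (Fin n) λ z → E x z × ReachIn (λ a → Q a × a ≢ x) z v
  cutAtLastVisit x {y} [] _ with y ≟ x
  ... | yes refl = inj₂ (inj₁ refl)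
  ... | no y≢x = inj₁ (y≢x ∷ [])
  cutAtLastVisit x {y} (e ∷ w) (_ ∷ Qw) with cutAtLastVisit x w Qw
  ... | inj₂ found = inj₂ found
  ... | inj₁ avoids with y ≟ x
  ...   | yes refl = inj₂ (inj₂ (_ , e , w , All.zip (Qw , avoids)))
  ...   | no y≢x = inj₁ (y≢x ∷ avoids)

  open import Data.List.Membership.DecPropositional (_≟_ {n}) using () renaming (_∈?_ to _∈ˡ?_)

  _∖_ : List (Fin n) → Fin n → List (Fin n)
  L ∖ x = filter (λ a → ¬? (a ≟ x)) L

  ∖-shorter : ∀ {x L} → x List.∈ L → length (L ∖ x) < length L
  ∖-shorter {x} {L} x∈L = filter-notAll (λ a → ¬? (a ≟ x)) L (Any.map (λ x≡a a≢x → a≢x (sym x≡a)) x∈L)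

  -- Reachability inside a list of at most k vertices is decidable, by
  -- induction on k: leave u along an edge and never come back.
  decReachWithin : ∀ k (L : List (Fin n)) → length L ≤ k → ∀ u v → Dec (ReachIn (List._∈ L) u v)
  decReachWithin zero [] _ u v = no λ { (w , inL) → ¬Any[] (All-head w inL) }
  decReachWithin (suc k) L |L|≤ u v with u ∈ˡ? L
  ... | no u∉L = no λ { (w , inL) → u∉L (All-head w inL) }
  ... | yes u∈L with u ≟ v
  ...   | yes refl = yes ([] , u∈L ∷ [])
  ...   | no u≢v with any? (λ z → E? u z ×-dec decReachWithin k (L ∖ u) (≤-pred (<-≤-trans (∖-shorter u∈L) |L|≤)) z v)
  ...     | yes (z , e , w , inL∖u) = yes (e ∷ w , u∈L ∷ All.map (λ m → proj₁ (∈-filter⁻ _ m)) inL∖u)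
  ...     | no none = no λ { (w , inL) → excluded w (cutAtLastVisit u w inL) }
    where
      excluded : (w : Walk E u v) →
        All (_≢ u) (verts w) ⊎ (u ≡ v) ⊎ Σ (Fin n) (λ z → E u z × ReachIn (λ a → a List.∈ L × a ≢ u) z v) → ⊥
      excluded w (inj₁ avoids) = All-head w avoids refl
      excluded w (inj₂ (inj₁ u≡v)) = u≢v u≡v
      excluded w (inj₂ (inj₂ (z , e , w' , inL'))) =
        none (z , e , w' , All.map (λ { (m , a≢u) → ∈-filter⁺ _ m a≢u }) inL')

  decReachIn : ∀ {Q : Fin n → Set} → (∀ v → Dec (Q v)) → ∀ u v → Dec (ReachIn Q u v)
  decReachIn Q? u v with decReachWithin _ (filter Q? (allFin n)) ≤-refl u v
  ... | yes (w , inL) = yes (w , All.map (λ m → proj₂ (∈-filter⁻ Q? {xs = allFin n} m)) inL)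
  ... | no ¬r = no λ { (w , Qw) → ¬r (w , All.map (∈-filter⁺ Q? (∈-allFin _)) Qw) }

  decWalk : ∀ u v → Dec (Walk E u v)
  decWalk u v with decReachIn (λ _ → yes tt) u v
  ... | yes (w , _) = yes w
  ... | no ¬r = no λ w → ¬r (w , All.tabulate (λ _ → tt))

  decReachBefore : ∀ {Q : Fin n → Set} → (∀ v → Dec (Q v)) → ∀ x v → Dec (ReachBefore Q x v)
  decReachBefore Q? x v = (x ≟ v) ⊎-dec any? (λ u → decReachIn Q? x u ×-dec E? u v)

  decReachAfter : ∀ {Q : Fin n → Set} → (∀ v → Dec (Q v)) → ∀ v y → Dec (ReachAfter Q v y)
  decReachAfter Q? v y = (v ≟ y) ⊎-dec any? (λ u → E? v u ×-dec decReachIn Q? u y)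

module Separators (G : StGraph) where
  open StGraph G
  open Walks E E?

  hits? : ∀ {u v} (w : Walk E u v) (A : Subset n) → Dec (Hits w A)
  hits? w A = Any.any? (_∈ˢ? A) (verts w)

  separator-blocks : ∀ {A} → Separator A → ¬ ReachIn (_∉ A) s t
  separator-blocks sep (w , avoids) = All¬⇒¬Any avoids (sep w)

  blocked⇒⊑ : ∀ {A v} → ¬ ReachIn (_∉ A) v t → v ⊑ᵥ A
  blocked⇒⊑ {A} blocked w with hits? w A
  ... | yes hit = hit
  ... | no miss = ⊥-elim (blocked (w , ¬Any⇒All¬ _ miss))

  -- A walk is private for x ∈ T if x is the only vertex of T on it.
  Private : Subset n → Fin n → Fin n → Set
  Private T x y = y ∈ T → y ≡ x

  -- Every vertex x of an mvs T lies on a private s-t walk, given here as its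
  -- halves before and after x: otherwise T - x would still separate,
  -- contradicting minimality.
  privateWalk : ∀ {T x} → IsMVS T → x ∈ T → ReachIn (Private T x) s x × ReachIn (Private T x) x t
  privateWalk {T} {x} (sep , minimal) x∈T with decReachIn (λ y → (y ∈ˢ? T) →-dec (y ≟ x)) s t
  ... | yes (w , isPrivate) with split w (sep w)
  ...   | y , y∈T , w₁ , w₂ , restrict with All-last w₁ (proj₁ (restrict isPrivate)) y∈T
  ...     | refl = (w₁ , proj₁ (restrict isPrivate)) , (w₂ , proj₂ (restrict isPrivate))
  privateWalk {T} {x} (_ , minimal) x∈T | no ¬r with x∈p⇒p-x⊂p x∈T
  ... | _ , y , y∈T , y∉T-x = ⊥-elim (y∉T-x (subst (y ∈_) (sym T-x≡T) y∈T))
    where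
      T-x-separates : Separator (T - x)
      T-x-separates w with hits? w (T - x)
      ... | yes hit = hit
      ... | no miss = ⊥-elim (¬r (w , All.map private-vertex (¬Any⇒All¬ _ miss)))
        where
          private-vertex : ∀ {y} → y ∉ T - x → Private T x y
          private-vertex {y} y∉T-x y∈T with y ≟ x
          ... | yes y≡x = y≡x
          ... | no y≢x = ⊥-elim (y∉T-x (x∈p∧x≢y⇒x∈p-y y∈T y≢x))
      T-x≡T : T - x ≡ T
      T-x≡T = minimal (T - x) (p─q⊆p T ⁅ x ⁆) T-x-separates

  FromS : Subset n → Fin n → Set
  FromS A v = ReachBefore (_∉ A) s v

  ToT : Subset n → Fin n → Set
  ToT B v = ReachAfter (_∉ B) v t

  fromS-blocked : ∀ {A A' v} → Separator A' → A' ⊆ A → FromS A v → ¬ ReachIn (_∉ A') v t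
  fromS-blocked sep A'⊆A fromS r = separator-blocks sep (reachBefore-join fromS (λ a∉A a∈A' → a∉A (A'⊆A a∈A')) r)

  fromS? : ∀ A v → Dec (FromS A v)
  fromS? A v = decReachBefore (λ a → ¬? (a ∈ˢ? A)) s v

  toT? : ∀ B v → Dec (ToT B v)
  toT? B v = decReachAfter (λ a → ¬? (a ∈ˢ? B)) v t

  inFront? : ∀ A v → Dec (v ∈ A × FromS A v)
  inFront? A v = (v ∈ˢ? A) ×-dec fromS? A v

  front : Subset n → Subset n
  front A = ⟦ inFront? A ⟧

  front⊆ : ∀ {A} → front A ⊆ A
  front⊆ {A} v∈ = proj₁ (∈⟦⟧⁻ (inFront? A) v∈)

  front-fromS : ∀ {A v} → v ∈ front A → FromS A v
  front-fromS {A} v∈ = proj₂ (∈⟦⟧⁻ (inFront? A) v∈)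

  ∈front : ∀ {A v} → v ∈ A → FromS A v → v ∈ front A
  ∈front {A} v∈A fromS = ∈⟦⟧⁺ (inFront? A) (v∈A , fromS)

  front-separates : ∀ {A} → Separator A → Separator (front A)
  front-separates {A} sep w =
    Any.map (λ { (v∈A , fromS) → ∈front v∈A fromS }) (firstHit (_∈ˢ? A) w (inj₁ refl) (sep w))

  inBack? : ∀ B v → Dec (v ∈ B × ToT B v)
  inBack? B v = (v ∈ˢ? B) ×-dec toT? B v

  back : Subset n → Subset n
  back B = ⟦ inBack? B ⟧

  back⊆ : ∀ {B} → back B ⊆ B
  back⊆ {B} v∈ = proj₁ (∈⟦⟧⁻ (inBack? B) v∈)

  back-toT : ∀ {B v} → v ∈ back B → ToT B v
  back-toT {B} v∈ = proj₂ (∈⟦⟧⁻ (inBack? B) v∈)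

  ∈back : ∀ {B v} → v ∈ B → ToT B v → v ∈ back B
  ∈back {B} v∈B toT = ∈⟦⟧⁺ (inBack? B) (v∈B , toT)

  back-separates : ∀ {B} → Separator B → Separator (back B)
  back-separates {B} sep w =
    Any.map (λ { (v∈B , toT) → ∈back v∈B toT }) (lastHit (_∈ˢ? B) w (sep w))

  closest : Subset n → Subset n
  closest X = back (front X)

  -- It is an mvs: a vertex v of closest X missed by a separator T' ⊆ closest X
  -- lies on an s-t walk that avoids front X before v and after v.
  closest-mvs : ∀ {X} → Separator X → IsMVS (closest X)
  closest-mvs {X} sep = back-separates (front-separates sep) , minimal
    where
      minimal : ∀ T' → T' ⊆ closest X → Separator T' → T' ≡ closest X
      minimal T' T'⊆Z sep' = ⊆-antisym T'⊆Z Z⊆T'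
        where
          Z⊆T' : closest X ⊆ T'
          Z⊆T' {v} v∈Z with v ∈ˢ? T'
          ... | yes v∈T' = v∈T'
          ... | no v∉T' = ⊥-elim (separator-blocks sep'
                (reachBefore-join (front-fromS (back⊆ v∈Z)) (λ a∉X a∈T' → a∉X (front⊆ (back⊆ (T'⊆Z a∈T'))))
                  (reachAfter-walk (back-toT v∈Z) (λ a∉F a∈T' → a∉F (back⊆ (T'⊆Z a∈T'))) v∉T')))

  closest-⊑ : ∀ {X A} → Separator A → A ⊆ X → closest X ⊑ A
  closest-⊑ sep A⊆X v v∈Z = blocked⇒⊑ (fromS-blocked sep A⊆X (front-fromS (back⊆ v∈Z)))

module Criticality (G : StGraph) where
  open StGraph G
  open Walks E E?
  open Separators G

  CriticalWitness : Subset n → Fin n → Set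
  CriticalWitness T b = Σ (Fin n) λ a → a ∈ T × Σ (Fin n) λ c → E a c × Walk E c b

  criticalWitness? : ∀ T b → Dec (CriticalWitness T b)
  criticalWitness? T b = any? λ a → (a ∈ˢ? T) ×-dec any? (λ c → E? a c ×-dec decWalk c b)

  module Contradiction
    {b T₀ a₀ c₀ T} (mvs₀ : IsMVS T₀) (b∈T₀ : b ∈ T₀) (a₀∈T₀ : a₀ ∈ T₀) (e₀ : E a₀ c₀) (p₀ : Walk E c₀ b)
    (mvsT : IsMVS T) (b∈T : b ∈ T) (minT : ∀ T' → IsMVS T' → T' ⊏ T → b ∉ T')
    (noWitness : ¬ CriticalWitness T b) where

    beforeEnd-∉T : ∀ {y} (w : Walk E y b) → AllBeforeEnd (_∉ T) w
    beforeEnd-∉T [] = tt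
    beforeEnd-∉T {y} (e ∷ w) = (λ y∈T → noWitness (y , y∈T , _ , e , w)) , beforeEnd-∉T w

    -- so does every vertex reaching a₀, as a₀ → c₀ ⇝ b
    reaches-a₀⇒∉T : ∀ {y} → Walk E y a₀ → y ∉ T
    reaches-a₀⇒∉T {y} [] y∈T = noWitness (y , y∈T , c₀ , e₀ , p₀)
    reaches-a₀⇒∉T {y} (e ∷ w) y∈T = noWitness (y , y∈T , _ , e , w ++ʷ (e₀ ∷ p₀))

    X : Subset n
    X = T ∪ T₀

    T⊆X : T ⊆ X
    T⊆X = p⊆p∪q T₀

    T₀⊆X : T₀ ⊆ X
    T₀⊆X = q⊆p∪q T T₀

    Z : Subset n
    Z = closest X

    -- The private walk of b in T₀ reaches b without meeting T ∪ T₀ earlier.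
    b∈front : b ∈ front X
    b∈front with privateWalk mvs₀ b∈T₀
    ... | (w , isPrivate) , _ = ∈front (T⊆X b∈T) (reachBefore-walk w (AllBeforeEnd-zipWith outside w (beforeEnd-∉T w) isPrivate))
      where
        outside : ∀ {y} → y ∉ T → Private T₀ b y → y ∉ X
        outside y∉T isPrivate y∈X with x∈p∪q⁻ T T₀ y∈X
        ... | inj₁ y∈T = y∉T y∈T
        ... | inj₂ y∈T₀ = y∉T (subst (_∈ T) (sym (isPrivate y∈T₀)) b∈T)

    -- After b, the private walk of b in T avoids T (a return to b would be a
    -- critical witness), hence avoids front X, whose vertices are ⊑ T.
    b-toT : ToT (front X) b
    b-toT with privateWalk mvsT b∈T
    ... | _ , ([] , _) = inj₁ refl
    ... | _ , (e ∷ w , _ ∷ isPrivate) = inj₂ (_ , e , w , All.tabulate outsideFront)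
      where
        avoidsT : All (_∉ T) (verts w)
        avoidsT = All.tabulate λ {y} y∈w y∈T →
          noWitness (b , b∈T , _ , e , subst (Walk E _) (All.lookup isPrivate y∈w y∈T) (prefix w y∈w))
        outsideFront : ∀ {z} → z List.∈ verts w → z ∉ front X
        outsideFront z∈w z∈F = fromS-blocked (proj₁ mvsT) T⊆X (front-fromS z∈F) (suffixReach w avoidsT z∈w)

    -- The private walk of a₀ in T₀ avoids T up to a₀ and must meet T
    -- afterwards, at some y; y is no first hit of X, for then the rest of
    -- the walk would meet T₀, i.e. lead from y back to a₀.
    missed : Σ (Fin n) λ y → y ∈ T × y ∉ front X
    missed with privateWalk mvs₀ a₀∈T₀
    ... | (w₁ , _) , (w₂ , isPrivate) with hits? w₂ T
    ...   | no miss = ⊥-elim (separator-blocks (proj₁ mvsT) (w₁ ++ʷ w₂ , All-++ʷ w₁ w₂ w₁-avoidsT (¬Any⇒All¬ _ miss)))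
      where
        w₁-avoidsT : All (_∉ T) (verts w₁)
        w₁-avoidsT = All.tabulate λ y∈w₁ → reaches-a₀⇒∉T (suffix w₁ y∈w₁)
    ...   | yes hit with split w₂ hit
    ...     | y , y∈T , _ , r , restrict = y , y∈T , notFront
      where
        notFront : y ∉ front X
        notFront y∈F with split r (blocked⇒⊑ (fromS-blocked (proj₁ mvs₀) T₀⊆X (front-fromS y∈F)) r)
        ... | z , z∈T₀ , q , _ , restrict₀ with All-last q (proj₁ (restrict₀ (proj₂ (restrict isPrivate)))) z∈T₀
        ...   | refl = reaches-a₀⇒∉T q y∈T

    -- Z ⊑ T, and Z ≠ T as Z misses a vertex of T.
    Z⊏T : Z ⊏ T
    Z⊏T with missed
    ... | y , y∈T , y∉F = closest-⊑ (proj₁ mvsT) T⊆X , λ Z≡T → y∉F (back⊆ (subst (y ∈_) (sym Z≡T) y∈T))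

    absurd : ⊥
    absurd = minT Z (closest-mvs (λ w → Any.map T⊆X (proj₁ mvsT w))) Z⊏T (∈back b∈front b-toT)

theorem3 : (G : StGraph) → (b : Fin (StGraph.n G)) → StGraph.CriticalNode G b →
    (T : Subset (StGraph.n G)) → StGraph.IsMinimal G b T → StGraph.IsCritical G b T
theorem3 G b (T₀ , mvs₀ , b∈T₀ , _ , a₀∈T₀ , _ , e₀ , p₀) T (mvsT , b∈T , minT)
  with Criticality.criticalWitness? G T b
... | yes witness = mvsT , b∈T , witness
... | no noWitness =
  ⊥-elim (Criticality.Contradiction.absurd G mvs₀ b∈T₀ a₀∈T₀ e₀ p₀ mvsT b∈T minT noWitness)
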